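{- Let $G$ be a connected graph with a countably infinite vertex set, and let $(G_n)_{n\in\mathbb{N}}$ be a subgraph tower in $G$. Let $e_1,e_2$ be two edges of $G_1$. If for every $n\in\mathbb{N}$ there is a NAC-coloring $\delta_n$ of $G_n$ with $\delta_n(e_1)\neq\delta_n(e_2)$, then $G$ has a NAC-coloring.
   Context: A subgraph tower in a connected graph $G$ is a sequence $(G_n)_{n\in\mathbb{N}}$ of finite, connected, induced subgraphs of $G$ such that $G_n$ is a proper subgraph of $G_{n+1}$ for all $n$ and $\bigcup_n V_{G_n}=V_G$. A NAC-coloring of a graph $H$ is a surjective map $\delta\colon E_H\to\{\text{red},\text{blue}\}$ such that every (finite) cycle of $H$ is either monochromatic or contains at least two edges of each color. -}

module Defs where

open import Level using (0ℓ)
open import Data.Nat using (ℕ; zero; suc; _≤_; _<?_; s≤s; _+_)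
open import Data.Fin using (Fin; toℕ; fromℕ<)
open import Data.List using (List; map)
open import Data.List.Membership.Propositional using (_∈_; _∉_)
open import Data.List.Relation.Unary.All using (All)
open import Data.Product using (Σ; ∃; _×_; _,_)
open import Data.Sum using (_⊎_)
open import Data.Unit using (⊤)
open import Data.List using (allFin)
open import Relation.Nullary using (¬_; yes; no)
open import Relation.Binary.PropositionalEquality using (_≡_; _≢_)
open import Function.Definitions using (Injective)

record Graph : Set₁ where
  field
    E      : ℕ → ℕ → Set
    sym    : ∀ {u v} → E u v → E v u
    irrefl : ∀ {u} → ¬ E u u
open Graph public

-- Subgraphs induced by a vertex predicate S.
VSet : Set₁
VSet = ℕ → Set

All-V : VSet
All-V _ = ⊤

⟦_⟧ : List ℕ → VSet
⟦ xs ⟧ v = v ∈ xs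

module _ (G : Graph) where

  record Edge (S : VSet) : Set where
    constructor edge
    field
      src : ℕ
      tgt : ℕ
      srcS : S src
      tgtS : S tgt
      adj : E G src tgt

  data Walk (S : VSet) : ℕ → ℕ → Set where
    here : ∀ {u} → S u → Walk S u u
    step : ∀ {u w v} → S u → E G u w → Walk S w v → Walk S u v

  ConnectedOn : VSet → Set
  ConnectedOn S = ∀ u v → S u → S v → Walk S u v

  Connected : Set
  Connected = ConnectedOn All-V

  -- Subgraph tower (indexed from 0; index 0 is the paper's G₁),
  -- each Gₙ is the induced subgraph on the finite vertex set V n.
  record IsSubgraphTower (V : ℕ → List ℕ) : Set where
    field
      connected : ∀ n → ConnectedOn ⟦ V n ⟧
      subset    : ∀ n v → v ∈ V n → v ∈ V (suc n)
      proper    : ∀ n → ∃ λ v → v ∈ V (suc n) × v ∉ V n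
      exhaust   : ∀ v → ∃ λ n → v ∈ V n

_≈ₑ_ : ∀ {G S T} → Edge G S → Edge G T → Set
e ≈ₑ f = (Edge.src e ≡ Edge.src f × Edge.tgt e ≡ Edge.tgt f)
       ⊎ (Edge.src e ≡ Edge.tgt f × Edge.tgt e ≡ Edge.src f)

data Colour : Set where
  red blue : Colour

countC : Colour → List Colour → ℕ
countC c List.[] = 0
countC red  (red  List.∷ cs) = suc (countC red cs)
countC red  (blue List.∷ cs) = countC red cs
countC blue (blue List.∷ cs) = suc (countC blue cs)
countC blue (red  List.∷ cs) = countC blue cs

nextF : ∀ {n} → Fin (suc n) → Fin (suc n)
nextF {n} i with suc (toℕ i) <? suc n
... | yes p = fromℕ< p
... | no  _ = Data.Fin.zero

-- A (finite) cycle of G[S]: k = 3 + len distinct vertices,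
-- cyclically adjacent.
record Cycle (G : Graph) (S : VSet) : Set where
  field
    len  : ℕ
    vert : Fin (3 + len) → ℕ
    inj  : Injective _≡_ _≡_ vert
    inS  : ∀ i → S (vert i)
    adj  : ∀ i → E G (vert i) (vert (nextF i))

  edgeAt : Fin (3 + len) → Edge G S
  edgeAt i = edge (vert i) (vert (nextF i)) (inS i) (inS (nextF i)) (adj i)

record IsNAC (G : Graph) (S : VSet) (δ : Edge G S → Colour) : Set where
  field
    welldef : ∀ e f → e ≈ₑ f → δ e ≡ δ f
    surj    : (∃ λ e → δ e ≡ red) × (∃ λ e → δ e ≡ blue)
    cycles  : ∀ (C : Cycle G S) →
      let open Cycle C
          cols = map (λ i → δ (edgeAt i)) (allFin (3 + len))
      in (∀ i j → δ (edgeAt i) ≡ δ (edgeAt j))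
         ⊎ (2 ≤ countC red cols × 2 ≤ countC blue cols)

NAC : (G : Graph) → VSet → Set
NAC G S = Σ (Edge G S → Colour) (IsNAC G S)

{-# OPTIONS --safe #-}
module Submission where

-- König-style compactness. Code the ordered vertex pairs by natural numbers and fix
-- the colour of pair j at stage j, keeping the invariant that every level of the tower
-- still carries a NAC-colouring separating e₁ and e₂ that agrees with the colours chosen
-- so far. Such colourings restrict to lower levels (separation keeps the restriction
-- surjective), so the levels at which a colour choice fails form an up-set; if both
-- choices failed, the larger of the two failing levels would admit no consistent
-- colouring at all. The limit colouring of G is a NAC-colouring because each of its
-- conditions involves finitely many edges, and on these it agrees with a separating
-- NAC-colouring of a single level.

open import Defs hiding (sym)
open import Level using (0ℓ)
open import Axiom.ExcludedMiddle using (ExcludedMiddle)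
open import Axiom.DoubleNegationElimination using (em⇒dne)
open import Data.Nat using (ℕ; zero; suc; _+_; _∸_; _≤_; _<_; _⊔_; _≤′_; ≤′-refl; ≤′-step; z≤n; s≤s; _<?_)
open import Data.Nat.Properties
open import Data.List using (List; map; allFin)
open import Data.List.Properties using (map-cong)
open import Data.List.Membership.Propositional using (_∈_)
open import Data.Fin using (Fin)
import Data.Fin as Fin
open import Data.Vec.Functional using ([]; _∷_)
open import Data.Product using (Σ; ∃; _×_; _,_; proj₁; proj₂)
open import Data.Product.Properties using (,-injective)
open import Data.Sum using (_⊎_; inj₁; inj₂; [_,_])
open import Data.Unit using (tt)
open import Function using (_∘_)
open import Relation.Nullary using (¬_; yes; no; contradiction)
open import Relation.Binary.PropositionalEquality using (_≡_; _≢_; refl; sym; trans; cong; subst; module ≡-Reasoning)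

triangle : ℕ → ℕ
triangle zero    = 0
triangle (suc s) = suc (triangle s + s)

pair : ℕ → ℕ → ℕ
pair u v = triangle (u + v) + u

-- Cantor's zig-zag: runs along the anti-diagonal u + v = s from (0 , s) to (s , 0).
next : ℕ × ℕ → ℕ × ℕ
next (u , zero)  = (0 , suc u)
next (u , suc v) = (suc u , v)

unpair : ℕ → ℕ × ℕ
unpair zero    = (0 , 0)
unpair (suc j) = next (unpair j)

unpair-triangle  : ∀ s → unpair (triangle s) ≡ (0 , s)
unpair-triangle+ : ∀ s u → u ≤ s → unpair (triangle s + u) ≡ (u , s ∸ u)
unpair-triangle zero = refl
unpair-triangle (suc s) rewrite unpair-triangle+ s s ≤-refl | n∸n≡0 s = refl
unpair-triangle+ s zero _ rewrite +-identityʳ (triangle s) = unpair-triangle s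
unpair-triangle+ (suc s) (suc u) (s≤s u≤s) = begin
  unpair (triangle (suc s) + suc u)    ≡⟨ cong unpair (+-suc (triangle (suc s)) u) ⟩
  next (unpair (triangle (suc s) + u)) ≡⟨ cong next (unpair-triangle+ (suc s) u (m≤n⇒m≤1+n u≤s)) ⟩
  next (u , suc s ∸ u)                 ≡⟨ cong (λ v → next (u , v)) (+-∸-assoc 1 u≤s) ⟩
  (suc u , s ∸ u)                      ∎
  where open ≡-Reasoning

unpair-pair : ∀ u v → unpair (pair u v) ≡ (u , v)
unpair-pair u v rewrite unpair-triangle+ (u + v) u (m≤m+n u v) | m+n∸m≡n u v = refl

pair-injective : ∀ {u v u′ v′} → pair u v ≡ pair u′ v′ → u ≡ u′ × v ≡ v′
pair-injective {u} {v} {u′} {v′} eq =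
  ,-injective (trans (sym (unpair-pair u v)) (trans (cong unpair eq) (unpair-pair u′ v′)))

finite-bound : ∀ {k} (f : Fin k → ℕ) → ∃ λ b → ∀ i → f i ≤ b
finite-bound {zero}  f = 0 , λ ()
finite-bound {suc k} f with finite-bound (f ∘ Fin.suc)
... | b , f≤b = f Fin.zero ⊔ b , λ where
  Fin.zero    → m≤m⊔n (f Fin.zero) b
  (Fin.suc i) → ≤-trans (f≤b i) (m≤n⊔m (f Fin.zero) b)

DownClosed : (ℕ → Set) → Set
DownClosed P = ∀ {m n} → m ≤ n → P n → P m

module _ (em : ExcludedMiddle 0ℓ) where

  ¬∀⇒∃¬ : {P : ℕ → Set} → ¬ (∀ n → P n) → ∃ λ n → ¬ P n
  ¬∀⇒∃¬ {P} ¬∀P with em {∃ λ n → ¬ P n}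
  ... | yes ∃¬P = ∃¬P
  ... | no ¬∃¬P = contradiction (λ n → em⇒dne em λ ¬Pn → ¬∃¬P (n , ¬Pn)) ¬∀P

  down-closed-cover : {P Q : ℕ → Set} → DownClosed P → DownClosed Q →
                      (∀ n → P n ⊎ Q n) → (∀ n → P n) ⊎ (∀ n → Q n)
  down-closed-cover {P} P↓ Q↓ P∪Q with em {∀ n → P n}
  ... | yes ∀P = inj₁ ∀P
  ... | no ¬∀P with ¬∀⇒∃¬ ¬∀P
  ...   | m , ¬Pm = inj₂ λ n →
    [ (λ Pn⊔m → contradiction (P↓ (m≤n⊔m n m) Pn⊔m) ¬Pm) , Q↓ (m≤m⊔n n m) ] (P∪Q (n ⊔ m))

extend : ℕ → (ℕ → Colour) → Colour → ℕ → Colour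
extend K a c j with j <? K
... | yes _ = a j
... | no  _ = c

extend-< : ∀ {K j} a c → j < K → extend K a c j ≡ a j
extend-< {K} {j} a c j<K with j <? K
... | yes _   = refl
... | no j≮K = contradiction j<K j≮K

extend-≡ : ∀ K a c → extend K a c K ≡ c
extend-≡ K a c with K <? K
... | yes K<K = contradiction K<K (<-irrefl refl)
... | no _    = refl

module Compactness
  (em : ExcludedMiddle 0ℓ)
  {X : ℕ → Set}
  (restrict : ∀ {m n} → m ≤ n → X n → X m)
  (Assigns : ∀ {n} → X n → ℕ → Colour → Set)
  (assigns-restrict : ∀ {m n} (m≤n : m ≤ n) (x : X n) {j c} →
                      Assigns (restrict m≤n x) j c → Assigns x j c)
  (assigns-functional : ∀ {n} (x : X n) {j c d} → Assigns x j c → Assigns x j d → c ≡ d)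
  (inhabited : ∀ n → X n)
  where

  Agrees : ∀ {n} → X n → ℕ → (ℕ → Colour) → Set
  Agrees x K a = ∀ {j c} → j < K → Assigns x j c → c ≡ a j

  ExtendableAt : ℕ → (ℕ → Colour) → ℕ → Set
  ExtendableAt K a n = Σ (X n) λ x → Agrees x K a

  Extendable : ℕ → (ℕ → Colour) → Set
  Extendable K a = ∀ n → ExtendableAt K a n

  extendableAt-downClosed : ∀ K a → DownClosed (ExtendableAt K a)
  extendableAt-downClosed K a m≤n (x , agree) =
    restrict m≤n x , λ j<K x↦c → agree j<K (assigns-restrict m≤n x x↦c)

  agrees-extend : ∀ {n K a c} {x : X n} → Agrees x K a →
                  (∀ {d} → Assigns x K d → d ≡ c) → Agrees x (suc K) (extend K a c)
  agrees-extend {K = K} {a} {c} agree atK {j} j<1+K x↦d with m<1+n⇒m<n∨m≡n j<1+K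
  ... | inj₁ j<K  = trans (agree j<K x↦d) (sym (extend-< a c j<K))
  ... | inj₂ refl = trans (atK x↦d) (sym (extend-≡ K a c))

  agrees-some-extend : ∀ {n K a} (x : X n) → Agrees x K a →
                       ∃ λ c → Agrees x (suc K) (extend K a c)
  agrees-some-extend {K = K} x agree with em {∃ (Assigns x K)}
  ... | yes (c , x↦c) = c , agrees-extend agree (λ x↦d → assigns-functional x x↦d x↦c)
  ... | no ¬∃x↦       = red , agrees-extend agree (λ x↦d → contradiction (_ , x↦d) ¬∃x↦)

  extendable-cover : ∀ {K a} → Extendable K a → ∀ n →
    ExtendableAt (suc K) (extend K a red) n ⊎ ExtendableAt (suc K) (extend K a blue) n
  extendable-cover ext n with agrees-some-extend (proj₁ (ext n)) (proj₂ (ext n))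
  ... | red  , agree = inj₁ (_ , agree)
  ... | blue , agree = inj₂ (_ , agree)

  extendable-step : ∀ {K a} → Extendable K a → ∃ λ c → Extendable (suc K) (extend K a c)
  extendable-step {K} {a} ext
    with down-closed-cover em (extendableAt-downClosed (suc K) (extend K a red))
                              (extendableAt-downClosed (suc K) (extend K a blue))
                              (extendable-cover ext)
  ... | inj₁ ext-red  = red  , ext-red
  ... | inj₂ ext-blue = blue , ext-blue

  Approximation : ℕ → Set
  Approximation K = Σ (ℕ → Colour) (Extendable K)

  grow : ∀ {K} → Approximation K → Approximation (suc K)
  grow {K} (a , ext) = extend K a (proj₁ (extendable-step ext)) , proj₂ (extendable-step ext)

  grow-< : ∀ {K j} (s : Approximation K) → j < K → proj₁ (grow s) j ≡ proj₁ s j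
  grow-< (a , ext) = extend-< a _

  approximation : ∀ K → Approximation K
  approximation zero    = (λ _ → red) , λ n → inhabited n , λ ()
  approximation (suc K) = grow (approximation K)

  limit : ℕ → Colour
  limit j = proj₁ (approximation (suc j)) j

  approximation-limit : ∀ {K j} → j < K → proj₁ (approximation K) j ≡ limit j
  approximation-limit {suc K} {j} j<1+K with m<1+n⇒m<n∨m≡n j<1+K
  ... | inj₁ j<K  = trans (grow-< (approximation K) j<K) (approximation-limit j<K)
  ... | inj₂ refl = refl

  limit-extendable : ∀ K → Extendable K limit
  limit-extendable K n with proj₂ (approximation K) n
  ... | x , agree = x , λ j<K x↦c → trans (agree j<K x↦c) (approximation-limit j<K)

both-colours : ∀ {A : Set} (δ : A → Colour) (a b : A) → δ a ≢ δ b →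
               (∃ λ e → δ e ≡ red) × (∃ λ e → δ e ≡ blue)
both-colours δ a b δa≢δb with δ a in δa | δ b in δb
... | red  | red  = contradiction refl δa≢δb
... | red  | blue = (a , δa) , (b , δb)
... | blue | red  = (b , δb) , (a , δa)
... | blue | blue = contradiction refl δa≢δb

CycleCondition : ∀ {k} → (Fin k → Colour) → Set
CycleCondition {k} col = (∀ i j → col i ≡ col j)
  ⊎ (2 ≤ countC red (map col (allFin k)) × 2 ≤ countC blue (map col (allFin k)))

CycleCondition-cong : ∀ {k} {col col′ : Fin k → Colour} →
                      (∀ i → col i ≡ col′ i) → CycleCondition col → CycleCondition col′
CycleCondition-cong col≗col′ (inj₁ mono) =
  inj₁ λ i j → trans (sym (col≗col′ i)) (trans (mono i j) (col≗col′ j))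
CycleCondition-cong {k} col≗col′ (inj₂ (r , b)) =
  inj₂ (subst (λ cs → 2 ≤ countC red cs) same r , subst (λ cs → 2 ≤ countC blue cs) same b)
  where same = map-cong col≗col′ (allFin k)

_⊆_ : VSet → VSet → Set
S ⊆ T = ∀ {v} → S v → T v

module _ {G : Graph} {S T : VSet} (S⊆T : S ⊆ T) where

  liftEdge : Edge G S → Edge G T
  liftEdge e = edge (Edge.src e) (Edge.tgt e) (S⊆T (Edge.srcS e)) (S⊆T (Edge.tgtS e)) (Edge.adj e)

  liftCycle : Cycle G S → Cycle G T
  liftCycle C = record { len = len ; vert = vert ; inj = inj ; inS = S⊆T ∘ inS ; adj = adj }
    where open Cycle C

  restrict-NAC : (δ : Edge G T → Colour) → IsNAC G T δ → (e f : Edge G S) →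
                 δ (liftEdge e) ≢ δ (liftEdge f) → IsNAC G S (δ ∘ liftEdge)
  restrict-NAC δ nac e f δe≢δf = record
    { welldef = λ e f e≈f → IsNAC.welldef nac (liftEdge e) (liftEdge f) e≈f
    ; surj    = both-colours (δ ∘ liftEdge) e f δe≢δf
    ; cycles  = IsNAC.cycles nac ∘ liftCycle
    }

module Tower {G : Graph} {V : ℕ → List ℕ} (tower : IsSubgraphTower G V)
             (e₁ e₂ : Edge G ⟦ V 0 ⟧) where

  open IsSubgraphTower tower

  ∈-mono′ : ∀ {m n v} → m ≤′ n → v ∈ V m → v ∈ V n
  ∈-mono′ ≤′-refl        v∈Vm = v∈Vm
  ∈-mono′ (≤′-step m≤′n) v∈Vm = subset _ _ (∈-mono′ m≤′n v∈Vm)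

  ∈-mono : ∀ {m n} → m ≤ n → ⟦ V m ⟧ ⊆ ⟦ V n ⟧
  ∈-mono m≤n = ∈-mono′ (≤⇒≤′ m≤n)

  Separating : ℕ → Set
  Separating n = Σ (NAC G ⟦ V n ⟧) λ δ →
    ∀ (f₁ f₂ : Edge G ⟦ V n ⟧) → f₁ ≈ₑ e₁ → f₂ ≈ₑ e₂ → proj₁ δ f₁ ≢ proj₁ δ f₂

  colouring : ∀ {n} → Separating n → Edge G ⟦ V n ⟧ → Colour
  colouring = proj₁ ∘ proj₁

  restrict-separating : ∀ {m n} → m ≤ n → Separating n → Separating m
  restrict-separating {m} m≤n ((δ , nac) , sep) =
    (δ ∘ liftEdge (∈-mono m≤n) , restrict-NAC (∈-mono m≤n) δ nac (lift₀ e₁) (lift₀ e₂)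
                                   (sep _ _ (inj₁ (refl , refl)) (inj₁ (refl , refl)))) ,
    λ f₁ f₂ → sep (liftEdge (∈-mono m≤n) f₁) (liftEdge (∈-mono m≤n) f₂)
    where
    lift₀ : Edge G ⟦ V 0 ⟧ → Edge G ⟦ V m ⟧
    lift₀ = liftEdge (∈-mono z≤n)

  Assigns : ∀ {n} → Separating n → ℕ → Colour → Set
  Assigns {n} x j c = ∃ λ (f : Edge G ⟦ V n ⟧) → pair (Edge.src f) (Edge.tgt f) ≡ j × colouring x f ≡ c

  assigns-restrict : ∀ {m n} (m≤n : m ≤ n) (x : Separating n) {j c} →
                     Assigns (restrict-separating m≤n x) j c → Assigns x j c
  assigns-restrict m≤n x (f , code , colour) = liftEdge (∈-mono m≤n) f , code , colour

  assigns-functional : ∀ {n} (x : Separating n) {j c d} → Assigns x j c → Assigns x j d → c ≡ d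
  assigns-functional ((δ , nac) , _) (f , code , refl) (f′ , code′ , refl) =
    IsNAC.welldef nac f f′ (inj₁ (pair-injective (trans code (sym code′))))

  module Limit (em : ExcludedMiddle 0ℓ) (separating : ∀ n → Separating n) where

    open Compactness em restrict-separating Assigns assigns-restrict assigns-functional separating

    δ∞ : Edge G All-V → Colour
    δ∞ f = limit (pair (Edge.src f) (Edge.tgt f))

    record Localisation {k} (fs : Fin k → Edge G All-V) : Set where
      field
        level  : ℕ
        approx : Separating level
        src∈   : ∀ i → Edge.src (fs i) ∈ V level
        tgt∈   : ∀ i → Edge.tgt (fs i) ∈ V level
        agrees : ∀ i (s : Edge.src (fs i) ∈ V level) (t : Edge.tgt (fs i) ∈ V level) →
                 colouring approx (edge _ _ s t (Edge.adj (fs i))) ≡ δ∞ (fs i)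

    localise : ∀ {k} (fs : Fin k → Edge G All-V) → Localisation fs
    localise fs = record
      { level  = n
      ; approx = proj₁ (limit-extendable (suc K) n)
      ; src∈   = λ i → in-level (≤-trans (m≤m⊔n _ _) (levels≤n i))
      ; tgt∈   = λ i → in-level (≤-trans (m≤n⊔m _ _) (levels≤n i))
      ; agrees = λ i s t → proj₂ (limit-extendable (suc K) n) (s≤s (codes≤K i)) (_ , refl , refl)
      }
      where
      level-of : ℕ → ℕ
      level-of v = proj₁ (exhaust v)
      in-level : ∀ {v n} → level-of v ≤ n → v ∈ V n
      in-level {v} le = ∈-mono le (proj₂ (exhaust v))
      levels = finite-bound λ i → level-of (Edge.src (fs i)) ⊔ level-of (Edge.tgt (fs i))
      n = proj₁ levels
      levels≤n = proj₂ levels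
      codes = finite-bound λ i → pair (Edge.src (fs i)) (Edge.tgt (fs i))
      K = proj₁ codes
      codes≤K = proj₂ codes

    δ∞-welldef : ∀ e f → e ≈ₑ f → δ∞ e ≡ δ∞ f
    δ∞-welldef e f e≈f = begin
      δ∞ e                ≡⟨ sym (agrees Fin.zero _ _) ⟩
      colouring approx e′ ≡⟨ IsNAC.welldef (proj₂ (proj₁ approx)) e′ f′ e≈f ⟩
      colouring approx f′ ≡⟨ agrees (Fin.suc Fin.zero) _ _ ⟩
      δ∞ f                ∎
      where
      open ≡-Reasoning
      open Localisation (localise (e ∷ f ∷ []))
      e′ = edge _ _ (src∈ Fin.zero) (tgt∈ Fin.zero) (Edge.adj e)
      f′ = edge _ _ (src∈ (Fin.suc Fin.zero)) (tgt∈ (Fin.suc Fin.zero)) (Edge.adj f)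

    toAll : Edge G ⟦ V 0 ⟧ → Edge G All-V
    toAll e = edge (Edge.src e) (Edge.tgt e) tt tt (Edge.adj e)

    δ∞-surjective : (∃ λ e → δ∞ e ≡ red) × (∃ λ e → δ∞ e ≡ blue)
    δ∞-surjective = both-colours δ∞ (toAll e₁) (toAll e₂) λ δ∞e₁≡δ∞e₂ →
      proj₂ approx e₁′ e₂′ (inj₁ (refl , refl)) (inj₁ (refl , refl))
        (trans (agrees Fin.zero _ _) (trans δ∞e₁≡δ∞e₂ (sym (agrees (Fin.suc Fin.zero) _ _))))
      where
      open Localisation (localise (toAll e₁ ∷ toAll e₂ ∷ []))
      e₁′ = edge _ _ (src∈ Fin.zero) (tgt∈ Fin.zero) (Edge.adj e₁)
      e₂′ = edge _ _ (src∈ (Fin.suc Fin.zero)) (tgt∈ (Fin.suc Fin.zero)) (Edge.adj e₂)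

    δ∞-cycles : ∀ (C : Cycle G All-V) → CycleCondition (δ∞ ∘ Cycle.edgeAt C)
    δ∞-cycles C = CycleCondition-cong (λ i → agrees i (src∈ i) (src∈ (nextF i)))
                                      (IsNAC.cycles (proj₂ (proj₁ approx)) C′)
      where
      open Localisation (localise (Cycle.edgeAt C))
      open Cycle C
      C′ : Cycle G ⟦ V level ⟧
      C′ = record { len = len ; vert = vert ; inj = inj ; inS = src∈ ; adj = adj }

    δ∞-NAC : NAC G All-V
    δ∞-NAC = δ∞ , record { welldef = δ∞-welldef ; surj = δ∞-surjective ; cycles = δ∞-cycles }

lemma3p4 : ExcludedMiddle 0ℓ →
    (G : Graph) → Connected G →
    (V : ℕ → List ℕ) → IsSubgraphTower G V →
    (e₁ e₂ : Edge G ⟦ V 0 ⟧) →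
    (∀ n → Σ (NAC G ⟦ V n ⟧) λ δ →
       ∀ (f₁ f₂ : Edge G ⟦ V n ⟧) → f₁ ≈ₑ e₁ → f₂ ≈ₑ e₂ →
       Σ.proj₁ δ f₁ ≢ Σ.proj₁ δ f₂) →
    NAC G All-V
lemma3p4 em G _ V tower e₁ e₂ separating = Tower.Limit.δ∞-NAC tower e₁ e₂ em separating
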